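{- Let $H$ be a finite graph and $G$ a graph. (1) For a fixed homomorphism $f:G\to H$, the set of automorphisms of $G$ that are preserving relative to $f$ is a subgroup of $\mathrm{Aut}(G)$. (2) Distinguishing homomorphisms do not compose in general: there exist graphs $G,H,K$ and distinguishing homomorphisms $f:G\to H$, $g:H\to K$ such that $g\circ f$ is not a distinguishing homomorphism. (3) If $f:G\to H$ is a homomorphism and $\beta\in\mathrm{Aut}(H)$, then $f$ is a distinguishing homomorphism if and only if $\beta f$ is a distinguishing homomorphism. (4) If $G$ is uniquely $H$-colourable, then either all homomorphisms $G\to H$ are distinguishing or none are. (5) Let $G_1$ and $G_2$ be connected, non-isomorphic graphs with disjoint vertex sets. If $f_1:G_1\to H$ and $f_2:G_2\to H$ are distinguishing homomorphisms, then $f_1\cup f_2:G_1\cup G_2\to H$ is a distinguishing homomorphism.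
   Context: All graphs are simple, undirected and countable. A homomorphism $f:G\to H$ is a map $V(G)\to V(H)$ such that $xy\in E(G)$ implies $f(x)f(y)\in E(H)$. An automorphism $\alpha$ of $G$ is preserving relative to a homomorphism $f:G\to H$ if $\alpha(f^{ -1}(x))=f^{ -1}(x)$ for every $x\in V(H)$ (equivalently $f\circ\alpha=f$). A homomorphism $f$ is distinguishing if the identity is the only automorphism of $G$ preserving relative to $f$. $G$ is uniquely $H$-colourable if it admits a homomorphism to $H$, every homomorphism $G\to H$ is onto, and for any two homomorphisms $f,g:G\to H$ there is $\alpha\in\mathrm{Aut}(H)$ with $f=\alpha g$. $G_1\cup G_2$ denotes the disjoint union, and $f_1\cup f_2$ the map agreeing with $f_i$ on $V(G_i)$. -}

module Defs where

open import Data.Nat using (ℕ)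
open import Data.Fin using (Fin)
open import Data.Product using (Σ; ∃; _×_; _,_)
open import Data.Sum using (_⊎_; inj₁; inj₂; [_,_])
open import Data.Empty using (⊥)
open import Function using (_∘_; id)
open import Function.Bundles using (_↔_)
open import Function.Definitions using (Injective)
open import Relation.Nullary using (¬_)
open import Relation.Binary.PropositionalEquality using (_≡_; refl; cong)

record Graph : Set₁ where
  field
    V      : Set
    Adj    : V → V → Set
    sym    : ∀ {x y} → Adj x y → Adj y x
    irrefl : ∀ {x} → ¬ Adj x x
open Graph public

Countable : Graph → Set
Countable G = Σ (V G → ℕ) λ e → Injective _≡_ _≡_ e

Finite : Graph → Set
Finite G = Σ ℕ λ n → V G ↔ Fin n

record Hom (G H : Graph) : Set where
  field
    map   : V G → V H
    pres  : ∀ {x y} → Adj G x y → Adj H (map x) (map y)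
open Hom public

record Iso (G H : Graph) : Set where
  field
    to    : V G → V H
    from  : V H → V G
    from∘to : ∀ x → from (to x) ≡ x
    to∘from : ∀ y → to (from y) ≡ y
    pres  : ∀ {x y} → Adj G x y → Adj H (to x) (to y)
    refl' : ∀ {x y} → Adj H (to x) (to y) → Adj G x y
open Iso public

Aut : Graph → Set
Aut G = Iso G G

-- Group structure on Aut G (equality of automorphisms is pointwise equality of 'to').
idAut : (G : Graph) → Aut G
idAut G = record { to = id ; from = id ; from∘to = λ _ → refl ; to∘from = λ _ → refl
                 ; pres = id ; refl' = id }

_∘ᴬ_ : {G : Graph} → Aut G → Aut G → Aut G
_∘ᴬ_ {G} α β = record
  { to = to α ∘ to β
  ; from = from β ∘ from α
  ; from∘to = λ x → trans' (cong (from β) (from∘to α (to β x))) (from∘to β x)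
  ; to∘from = λ y → trans' (cong (to α) (to∘from β (from α y))) (to∘from α y)
  ; pres = pres α ∘ pres β
  ; refl' = refl' β ∘ refl' α }
  where
  trans' : ∀ {A : Set} {a b c : A} → a ≡ b → b ≡ c → a ≡ c
  trans' refl q = q

invAut : {G : Graph} → Aut G → Aut G
invAut {G} α = record
  { to = from α ; from = to α ; from∘to = to∘from α ; to∘from = from∘to α
  ; pres = λ {x} {y} a → refl' α (subst2 (Adj G) (sym' (to∘from α x)) (sym' (to∘from α y)) a)
  ; refl' = λ {x} {y} a → subst2 (Adj G) (to∘from α x) (to∘from α y) (pres α a) }
  where
  sym' : ∀ {A : Set} {a b : A} → a ≡ b → b ≡ a
  sym' refl = refl
  subst2 : ∀ {A : Set} (R : A → A → Set) {a b c d : A} → a ≡ b → c ≡ d → R a c → R b d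
  subst2 R refl refl r = r

_∘ʰ_ : {G H K : Graph} → Hom H K → Hom G H → Hom G K
g ∘ʰ f = record { map = map g ∘ map f ; pres = pres g ∘ pres f }

_·_ : {G H : Graph} → Aut H → Hom G H → Hom G H
β · f = record { map = to β ∘ map f ; pres = pres β ∘ pres f }

Preserving : {G H : Graph} → Hom G H → Aut G → Set
Preserving f α = ∀ x → map f (to α x) ≡ map f x

Distinguishing : {G H : Graph} → Hom G H → Set
Distinguishing {G} f = (α : Aut G) → Preserving f α → ∀ x → to α x ≡ x

Surjective : {A B : Set} → (A → B) → Set
Surjective {A} {B} h = ∀ (y : B) → ∃ λ (x : A) → h x ≡ y

UniquelyColourable : Graph → Graph → Set
UniquelyColourable G H =
  Hom G H
  × ((f : Hom G H) → Surjective (map f))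
  × ((f g : Hom G H) → ∃ λ (α : Aut H) → ∀ x → map f x ≡ to α (map g x))

data Walk (G : Graph) : V G → V G → Set where
  here : ∀ {x} → Walk G x x
  step : ∀ {x y z} → Adj G x y → Walk G y z → Walk G x z

Connected : Graph → Set
Connected G = ∀ (u v : V G) → Walk G u v

data UAdj (G₁ G₂ : Graph) : V G₁ ⊎ V G₂ → V G₁ ⊎ V G₂ → Set where
  left  : ∀ {x y} → Adj G₁ x y → UAdj G₁ G₂ (inj₁ x) (inj₁ y)
  right : ∀ {x y} → Adj G₂ x y → UAdj G₁ G₂ (inj₂ x) (inj₂ y)

_∪ᴳ_ : Graph → Graph → Graph
G₁ ∪ᴳ G₂ = record
  { V = V G₁ ⊎ V G₂
  ; Adj = UAdj G₁ G₂
  ; sym = λ { (left a) → left (sym G₁ a) ; (right a) → right (sym G₂ a) }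
  ; irrefl = λ { (left a) → irrefl G₁ a ; (right a) → irrefl G₂ a } }

_∪ʰ_ : {G₁ G₂ H : Graph} → Hom G₁ H → Hom G₂ H → Hom (G₁ ∪ᴳ G₂) H
f₁ ∪ʰ f₂ = record
  { map = [ map f₁ , map f₂ ]
  ; pres = λ { (left a) → pres f₁ a ; (right a) → pres f₂ a } }

module Submission where

-- (1) and (3) are pointwise calculations: the equation f ∘ α = f is stable under
-- composition and inversion of α, and composing f with an automorphism β of H
-- does not change which automorphisms of G preserve f, since β is injective.
-- (4) follows from (3): two H-colourings of a uniquely H-colourable graph differ
-- by an automorphism of H, so being distinguishing is the same for all of them,
-- and a predicate that is constant in this sense is (up to double negation)
-- either true everywhere or false everywhere.
-- (2) is witnessed by paths: the embedding P₃ → P₄ is injective, hence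
-- distinguishing; the 3-colouring 0,1,0,2 of P₄ is distinguishing; but the
-- composite colouring 0,1,0 of P₃ is preserved by the reversal of P₃.
-- (5) rests on the automorphisms of a disjoint union G₁ ∪ G₂ of connected graphs:
-- one that moves a vertex of G₁ into G₂ moves all of G₁ onto G₂ and yields
-- G₁ ≅ G₂.  So if G₁ ≇ G₂, every automorphism restricts to automorphisms of G₁
-- and of G₂, and these are trivial when it preserves f₁ ∪ f₂.

open import Defs
open import Data.Product using (Σ; ∃; _×_; _,_)
open import Data.Sum using (_⊎_)
open import Relation.Nullary using (¬_)
open import Function.Bundles using (_⇔_)

open import Data.Product using (proj₁; proj₂)
open import Data.Sum using (inj₁; inj₂; [_,_]; [_,_]′) renaming (map to ⊎-map)
open import Data.Sum.Properties using (inj₁-injective; inj₂-injective)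
open import Data.Nat using (ℕ; zero; suc)
open import Data.Fin using (Fin; zero; suc; toℕ; inject₁; fromℕ; opposite)
open import Data.Fin.Patterns using (0F; 1F; 2F; 3F)
open import Data.Fin.Properties using (toℕ-injective; inject₁-injective; opposite-involutive)
open import Data.Empty using (⊥-elim)
open import Function using (_∘_; id)
open import Function.Bundles using (mk⇔; module Equivalence)
open import Function.Construct.Identity using (↔-id)
open import Relation.Binary.PropositionalEquality
  using (_≡_; _≢_; refl; trans; cong; subst; subst₂; module ≡-Reasoning)
  renaming (sym to ≡-sym)

aut-injective : {G : Graph} (α : Aut G) {a b : V G} → to α a ≡ to α b → a ≡ b
aut-injective α {a} {b} αa≡αb = begin
  a                 ≡⟨ ≡-sym (from∘to α a) ⟩
  from α (to α a)   ≡⟨ cong (from α) αa≡αb ⟩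
  from α (to α b)   ≡⟨ from∘to α b ⟩
  b                 ∎
  where open ≡-Reasoning

aut-from : {G : Graph} (α : Aut G) {x y : V G} → to α x ≡ y → from α y ≡ x
aut-from α {x} αx≡y = trans (cong (from α) (≡-sym αx≡y)) (from∘to α x)

module _ {G H : Graph} (f : Hom G H) where

  preserving-id : Preserving f (idAut G)
  preserving-id _ = refl

  preserving-∘ : (α β : Aut G) → Preserving f α → Preserving f β → Preserving f (α ∘ᴬ β)
  preserving-∘ α β fα≡f fβ≡f x = trans (fα≡f (to β x)) (fβ≡f x)

  preserving-inv : (α : Aut G) → Preserving f α → Preserving f (invAut α)
  preserving-inv α fα≡f x = begin
    map f (from α x)           ≡⟨ ≡-sym (fα≡f (from α x)) ⟩
    map f (to α (from α x))    ≡⟨ cong (map f) (to∘from α x) ⟩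
    map f x                    ∎
    where open ≡-Reasoning

distinguishing-resp : {G H : Graph} (f g : Hom G H) → (∀ x → map f x ≡ map g x) →
                      Distinguishing f → Distinguishing g
distinguishing-resp f g f≗g f-dist α gα≡g =
  f-dist α (λ x → trans (f≗g (to α x)) (trans (gα≡g x) (≡-sym (f≗g x))))

preserving-· : {G H : Graph} (f : Hom G H) (β : Aut H) (α : Aut G) →
               Preserving f α ⇔ Preserving (β · f) α
preserving-· f β α = mk⇔ (λ fα≡f x → cong (to β) (fα≡f x))
                         (λ βfα≡βf x → aut-injective β (βfα≡βf x))

distinguishing-· : {G H : Graph} (f : Hom G H) (β : Aut H) →
                   Distinguishing f ⇔ Distinguishing (β · f)
distinguishing-· f β = mk⇔
  (λ f-dist α p → f-dist α (Equivalence.from (preserving-· f β α) p))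
  (λ βf-dist α p → βf-dist α (Equivalence.to (preserving-· f β α) p))

all-or-none : {A : Set} (D : A → Set) → (∀ a b → D a → D b) →
              ¬ ¬ ((∀ a → D a) ⊎ (∀ a → ¬ D a))
all-or-none D transfer k = k (inj₂ (λ a Da → k (inj₁ (λ b → transfer a b Da))))

-- In a uniquely H-colourable graph, g = β · f for some β ∈ Aut H, so by (3)
-- one distinguishing colouring makes every colouring distinguishing.
unique-colouring-transfer : {G H : Graph} → UniquelyColourable G H →
                            (f g : Hom G H) → Distinguishing f → Distinguishing g
unique-colouring-transfer (_ , _ , unique) f g f-dist with unique g f
... | β , g≗βf = distinguishing-resp (β · f) g (λ x → ≡-sym (g≗βf x))
                   (Equivalence.to (distinguishing-· f β) f-dist)

data Consecutive : {n : ℕ} → Fin n → Fin n → Set where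
  first : {n : ℕ} → Consecutive {suc (suc n)} zero (suc zero)
  shift : {n : ℕ} {i j : Fin n} → Consecutive i j → Consecutive (suc i) (suc j)

consecutive-irrefl : {n : ℕ} {i : Fin n} → ¬ Consecutive i i
consecutive-irrefl (shift c) = consecutive-irrefl c

PathAdj : {n : ℕ} → Fin n → Fin n → Set
PathAdj i j = Consecutive i j ⊎ Consecutive j i

Path : ℕ → Graph
Path n = record
  { V = Fin n ; Adj = PathAdj ; sym = [ inj₂ , inj₁ ]
  ; irrefl = [ consecutive-irrefl , consecutive-irrefl ] }

Complete : ℕ → Graph
Complete n = record
  { V = Fin n ; Adj = _≢_ ; sym = λ x≢y → x≢y ∘ ≡-sym ; irrefl = λ x≢x → x≢x refl }

consecutive-inject₁ : {n : ℕ} {i j : Fin n} → Consecutive i j → Consecutive (inject₁ i) (inject₁ j)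
consecutive-inject₁ first     = first
consecutive-inject₁ (shift c) = shift (consecutive-inject₁ c)

path-inclusion : (n : ℕ) → Hom (Path n) (Path (suc n))
path-inclusion n = record
  { map = inject₁ ; pres = ⊎-map consecutive-inject₁ consecutive-inject₁ }

consecutive-last : (n : ℕ) → Consecutive (inject₁ (fromℕ n)) (fromℕ (suc n))
consecutive-last zero    = first
consecutive-last (suc n) = shift (consecutive-last n)

consecutive-opposite : {n : ℕ} {i j : Fin n} → Consecutive i j → Consecutive (opposite j) (opposite i)
consecutive-opposite {suc (suc n)} first = consecutive-last n
consecutive-opposite (shift c)           = consecutive-inject₁ (consecutive-opposite c)

reversal : (n : ℕ) → Aut (Path n)
reversal n = record
  { to = opposite ; from = opposite
  ; from∘to = opposite-involutive ; to∘from = opposite-involutive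
  ; pres = reverse
  ; refl' = λ {x} {y} a →
      subst₂ PathAdj (opposite-involutive x) (opposite-involutive y) (reverse a) }
  where
  reverse : {x y : Fin n} → PathAdj x y → PathAdj (opposite x) (opposite y)
  reverse = [ inj₂ ∘ consecutive-opposite , inj₁ ∘ consecutive-opposite ]

injective⇒distinguishing : {G H : Graph} (f : Hom G H) →
                           (∀ {a b} → map f a ≡ map f b → a ≡ b) → Distinguishing f
injective⇒distinguishing f injective α fα≡f x = injective (fα≡f x)

fixes-singleton-class : {G H : Graph} (f : Hom G H) (α : Aut G) → Preserving f α →
                        ∀ x → (∀ y → map f y ≡ map f x → y ≡ x) → to α x ≡ x
fixes-singleton-class f α fα≡f x alone = alone (to α x) (fα≡f x)

fixes-unique-neighbour : {G : Graph} (α : Aut G) {u v : V G} → Adj G u v → to α v ≡ v →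
                         (∀ {w} → Adj G w v → w ≡ u) → to α u ≡ u
fixes-unique-neighbour {G} α {u} uv αv≡v only-u = only-u (subst (Adj G (to α u)) αv≡v (pres α uv))

colouring : Fin 4 → Fin 3
colouring 0F = 0F
colouring 1F = 1F
colouring 2F = 0F
colouring 3F = 2F

colouring-proper : {i j : Fin 4} → Consecutive i j → colouring i ≢ colouring j
colouring-proper first                 ()
colouring-proper (shift first)         ()
colouring-proper (shift (shift first)) ()
colouring-proper (shift (shift (shift (shift ()))))

colouring-hom : Hom (Path 4) (Complete 3)
colouring-hom = record
  { map = colouring
  ; pres = [ colouring-proper , (λ c ci≡cj → colouring-proper c (≡-sym ci≡cj)) ] }

class-0 : ∀ v → colouring v ≡ 0F → v ≡ 0F ⊎ v ≡ 2F
class-0 0F _ = inj₁ refl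
class-0 2F _ = inj₂ refl
class-0 1F ()
class-0 3F ()

class-1 : ∀ v → colouring v ≡ 1F → v ≡ 1F
class-1 1F _ = refl
class-1 0F ()
class-1 2F ()
class-1 3F ()

class-2 : ∀ v → colouring v ≡ 2F → v ≡ 3F
class-2 3F _ = refl
class-2 0F ()
class-2 1F ()
class-2 2F ()

neighbour-of-3 : {w : Fin 4} → PathAdj w 3F → w ≡ 2F
neighbour-of-3 (inj₁ (shift (shift first)))  = refl
neighbour-of-3 (inj₂ (shift (shift (shift ()))))

-- The colouring 0,1,0,2 of P₄ is distinguishing: 1 and 3 are alone in their
-- colour classes, 2 is the unique neighbour of 3, and then 0 cannot go to 2.
colouring-distinguishing : Distinguishing colouring-hom
colouring-distinguishing α p = fixed
  where
  fixed-1 : to α 1F ≡ 1F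
  fixed-1 = fixes-singleton-class colouring-hom α p 1F class-1
  fixed-3 : to α 3F ≡ 3F
  fixed-3 = fixes-singleton-class colouring-hom α p 3F class-2
  fixed-2 : to α 2F ≡ 2F
  fixed-2 = fixes-unique-neighbour α (inj₁ (shift (shift first))) fixed-3 neighbour-of-3
  fixed-0 : to α 0F ≡ 0F
  fixed-0 with class-0 (to α 0F) (p 0F)
  ... | inj₁ α0≡0 = α0≡0
  ... | inj₂ α0≡2 with aut-injective α (trans α0≡2 (≡-sym fixed-2))
  ...   | ()
  fixed : ∀ x → to α x ≡ x
  fixed 0F = fixed-0
  fixed 1F = fixed-1
  fixed 2F = fixed-2
  fixed 3F = fixed-3

composite-not-distinguishing : ¬ Distinguishing (colouring-hom ∘ʰ path-inclusion 3)
composite-not-distinguishing dist with dist (reversal 3) reversal-preserves 0F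
  where
  reversal-preserves : Preserving (colouring-hom ∘ʰ path-inclusion 3) (reversal 3)
  reversal-preserves 0F = refl
  reversal-preserves 1F = refl
  reversal-preserves 2F = refl
... | ()

walk-closed : (G : Graph) (P : V G → Set) → (∀ {a b} → Adj G a b → P a → P b) →
              ∀ {a b} → Walk G a b → P a → P b
walk-closed G P along-edge here       Pa = Pa
walk-closed G P along-edge (step e w) Pa = walk-closed G P along-edge w (along-edge e Pa)

module DisjointUnion (G₁ G₂ : Graph) where

  U : Graph
  U = G₁ ∪ᴳ G₂

  -- A side of the union: an embedded copy of A that is a union of components
  -- (every edge starting in the image of ι ends in it).
  record Side (A : Graph) : Set where
    field
      ι         : V A → V U
      injective : ∀ {a b} → ι a ≡ ι b → a ≡ b
      preserves : ∀ {a b} → Adj A a b → Adj U (ι a) (ι b)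
      reflects  : ∀ {a b} → Adj U (ι a) (ι b) → Adj A a b
      closed    : ∀ {a w} → Adj U (ι a) w → ∃ λ b → ι b ≡ w
  open Side

  _∈_ : {A : Graph} → V U → Side A → Set
  z ∈ s = ∃ λ a → ι s a ≡ z

  side₁ : Side G₁
  side₁ = record
    { ι = inj₁ ; injective = inj₁-injective ; preserves = left
    ; reflects = λ { (left e) → e } ; closed = λ { (left e) → _ , refl } }

  side₂ : Side G₂
  side₂ = record
    { ι = inj₂ ; injective = inj₂-injective ; preserves = right
    ; reflects = λ { (right e) → e } ; closed = λ { (right e) → _ , refl } }

  which-side : (z : V U) → z ∈ side₁ ⊎ z ∈ side₂
  which-side (inj₁ x) = inj₁ (x , refl)
  which-side (inj₂ y) = inj₂ (y , refl)

  Sends : {A B : Graph} → Aut U → Side A → Side B → Set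
  Sends {A} σ s t = (a : V A) → to σ (ι s a) ∈ t

  side-iso : {A B : Graph} (σ : Aut U) (s : Side A) (t : Side B) →
             Sends σ s t → Sends (invAut σ) t s → Iso A B
  side-iso {A} {B} σ s t σ[s]⊆t σ⁻¹[t]⊆s = record
    { to = τ ; from = ρ
    ; from∘to = λ a → injective s (begin
        ι s (ρ (τ a))          ≡⟨ ρ-spec (τ a) ⟩
        from σ (ι t (τ a))     ≡⟨ aut-from σ (≡-sym (τ-spec a)) ⟩
        ι s a                  ∎)
    ; to∘from = λ b → injective t (begin
        ι t (τ (ρ b))          ≡⟨ τ-spec (ρ b) ⟩
        to σ (ι s (ρ b))       ≡⟨ cong (to σ) (ρ-spec b) ⟩
        to σ (from σ (ι t b))  ≡⟨ to∘from σ (ι t b) ⟩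
        ι t b                  ∎)
    ; pres = λ {a} {b} e → reflects t
        (subst₂ (Adj U) (≡-sym (τ-spec a)) (≡-sym (τ-spec b)) (pres σ (preserves s e)))
    ; refl' = λ {a} {b} e → reflects s
        (refl' σ (subst₂ (Adj U) (τ-spec a) (τ-spec b) (preserves t e))) }
    where
    open ≡-Reasoning
    τ : V A → V B
    τ a = proj₁ (σ[s]⊆t a)
    τ-spec : ∀ a → ι t (τ a) ≡ to σ (ι s a)
    τ-spec a = proj₂ (σ[s]⊆t a)
    ρ : V B → V A
    ρ b = proj₁ (σ⁻¹[t]⊆s b)
    ρ-spec : ∀ b → ι s (ρ b) ≡ from σ (ι t b)
    ρ-spec b = proj₂ (σ⁻¹[t]⊆s b)

  spread : {A B : Graph} (σ : Aut U) (s : Side A) (t : Side B) → Connected A →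
           ∀ a₀ → to σ (ι s a₀) ∈ t → Sends σ s t
  spread {A} σ s t connected a₀ σa₀∈t a =
    walk-closed A (λ a → to σ (ι s a) ∈ t) along-edge (connected a₀ a) σa₀∈t
    where
    along-edge : ∀ {a b} → Adj A a b → to σ (ι s a) ∈ t → to σ (ι s b) ∈ t
    along-edge {a} {b} e (c , ιc≡σa) =
      closed t (subst (λ z → Adj U z (to σ (ι s b))) (≡-sym ιc≡σa) (pres σ (preserves s e)))

  module Components (connected₁ : Connected G₁) (connected₂ : Connected G₂)
                    (G₁≇G₂ : ¬ Iso G₁ G₂) where

    -- No automorphism moves a vertex of G₁ into G₂: it would move all of G₁
    -- into G₂ and, inversely, all of G₂ into G₁, giving G₁ ≅ G₂.
    no-crossing : (σ : Aut U) → ∀ x → ¬ (to σ (inj₁ x) ∈ side₂)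
    no-crossing σ x σx∈G₂@(y , inj₂y≡σx) = G₁≇G₂ (side-iso σ side₁ side₂
      (spread σ side₁ side₂ connected₁ x σx∈G₂)
      (spread (invAut σ) side₂ side₁ connected₂ y (x , ≡-sym (aut-from σ (≡-sym inj₂y≡σx)))))

    keeps-side₁ : (σ : Aut U) → Sends σ side₁ side₁
    keeps-side₁ σ x = [ id , ⊥-elim ∘ no-crossing σ x ]′ (which-side (to σ (inj₁ x)))

    keeps-side₂ : (σ : Aut U) → Sends σ side₂ side₂
    keeps-side₂ σ y = [ ⊥-elim ∘ moved-into-G₁ , id ]′ (which-side (to σ (inj₂ y)))
      where
      moved-into-G₁ : ¬ (to σ (inj₂ y) ∈ side₁)
      moved-into-G₁ (x , inj₁x≡σy) =
        no-crossing (invAut σ) x (y , ≡-sym (aut-from σ (≡-sym inj₁x≡σy)))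

  restrict : {A H : Graph} → Hom U H → Side A → Hom A H
  restrict h s = record { map = map h ∘ ι s ; pres = pres h ∘ preserves s }

  fixes-side : {A H : Graph} (s : Side A) (σ : Aut U) → Sends σ s s →
               Sends (invAut σ) s s → (h : Hom U H) → Preserving h σ →
               Distinguishing (restrict h s) → ∀ a → to σ (ι s a) ≡ ι s a
  fixes-side {A} s σ σ[s]⊆s σ⁻¹[s]⊆s h hσ≡h h|s-dist a = begin
    to σ (ι s a)                 ≡⟨ ≡-sym (proj₂ (σ[s]⊆s a)) ⟩
    ι s (to σ|s a)               ≡⟨ cong (ι s) (h|s-dist σ|s σ|s-preserving a) ⟩
    ι s a                        ∎
    where
    open ≡-Reasoning
    σ|s : Aut A
    σ|s = side-iso σ s s σ[s]⊆s σ⁻¹[s]⊆s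
    σ|s-preserving : Preserving (restrict h s) σ|s
    σ|s-preserving b = trans (cong (map h) (proj₂ (σ[s]⊆s b))) (hσ≡h (ι s b))

union-distinguishing : {G₁ G₂ H : Graph} → Connected G₁ → Connected G₂ → ¬ Iso G₁ G₂ →
                       (f₁ : Hom G₁ H) (f₂ : Hom G₂ H) →
                       Distinguishing f₁ → Distinguishing f₂ → Distinguishing (f₁ ∪ʰ f₂)
union-distinguishing {G₁} {G₂} c₁ c₂ G₁≇G₂ f₁ f₂ f₁-dist f₂-dist σ p = fixed
  where
  open DisjointUnion G₁ G₂
  open Components c₁ c₂ G₁≇G₂
  fixed : ∀ z → to σ z ≡ z
  fixed (inj₁ x) = fixes-side side₁ σ (keeps-side₁ σ) (keeps-side₁ (invAut σ)) (f₁ ∪ʰ f₂) p f₁-dist x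
  fixed (inj₂ y) = fixes-side side₂ σ (keeps-side₂ σ) (keeps-side₂ (invAut σ)) (f₁ ∪ʰ f₂) p f₂-dist y

lemma2p1 : ((G H : Graph) → Countable G → Finite H → (f : Hom G H) →
    Preserving f (idAut G)
    × ((α β : Aut G) → Preserving f α → Preserving f β → Preserving f (α ∘ᴬ β))
    × ((α : Aut G) → Preserving f α → Preserving f (invAut α)))
    × (Σ Graph λ G → Σ Graph λ H → Σ Graph λ K →
    Countable G × Finite H × Finite K ×
    Σ (Hom G H) λ f → Σ (Hom H K) λ g →
    Distinguishing f × Distinguishing g × ¬ Distinguishing (g ∘ʰ f))
    × ((G H : Graph) → Countable G → Finite H → (f : Hom G H) → (β : Aut H) →
    Distinguishing f ⇔ Distinguishing (β · f))
    × ((G H : Graph) → Countable G → Finite H → UniquelyColourable G H →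
    ¬ ¬ (((f : Hom G H) → Distinguishing f) ⊎ ((f : Hom G H) → ¬ Distinguishing f)))
    × ((G₁ G₂ H : Graph) → Countable G₁ → Countable G₂ → Finite H →
    Connected G₁ → Connected G₂ → ¬ Iso G₁ G₂ →
    (f₁ : Hom G₁ H) → (f₂ : Hom G₂ H) →
    Distinguishing f₁ → Distinguishing f₂ → Distinguishing (f₁ ∪ʰ f₂))
lemma2p1 =
    (λ G H _ _ f → preserving-id f , preserving-∘ f , preserving-inv f)
  , ( Path 3 , Path 4 , Complete 3
    , (toℕ , toℕ-injective) , (4 , ↔-id _) , (3 , ↔-id _)
    , path-inclusion 3 , colouring-hom
    , injective⇒distinguishing (path-inclusion 3) inject₁-injective
    , colouring-distinguishing , composite-not-distinguishing)
  , (λ G H _ _ → distinguishing-·)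
  , (λ G H _ _ uc → all-or-none Distinguishing (unique-colouring-transfer uc))
  , (λ G₁ G₂ H _ _ _ → union-distinguishing)
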